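{- Let $m<p$ be positive integers, $\Sigma_m=\{0,\dots,m\}$, $f:\Sigma_m\to\{0,\dots,p\}$ strictly increasing with $f(0)=0$, $f(m)=p$, let $\{C_n\}$ be the associated Cantor-integers and $\alpha=\log(p+1)/\log(m+1)$. Then there exists $k_0\in\mathbb N$ such that for every integer $n\ge(m+1)^{k_0}$ and every $\epsilon\in\{1,\dots,m\}$, \[\frac{C_{(m+1)n+\epsilon}}{((m+1)n+\epsilon)^\alpha}\le\frac{C_n}{n^\alpha}.\]
   Context: Cantor-integers: for $n=\sum_{j=0}^k\epsilon_j(m+1)^j$ with $\epsilon_j\in\Sigma_m$, $C_n=\sum_{j=0}^k f(\epsilon_j)(p+1)^j$. -}

module Defs where

open import Data.Nat using (ℕ; zero; suc; _+_; _*_; _^_; _≤_; _<_)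
open import Data.Nat.DivMod using (_/_; _mod_)
open import Data.Fin using (Fin; toℕ; fromℕ) renaming (_<_ to _<ᶠ_)
open import Data.Product using (_×_)
open import Relation.Binary.PropositionalEquality using (_≡_)

StrictlyIncreasing : ∀ {m p} → (Fin (suc m) → Fin (suc p)) → Set
StrictlyIncreasing f = ∀ i j → i <ᶠ j → toℕ (f i) < toℕ (f j)

IsDigitMap : (m p : ℕ) → (Fin (suc m) → Fin (suc p)) → Set
IsDigitMap m p f =
  StrictlyIncreasing f × (toℕ (f Data.Fin.zero) ≡ 0) × (toℕ (f (fromℕ m)) ≡ p)

-- Cantor-integers: for n = Σ ε_j (m+1)^j (base m+1 digits ε_j),
-- C_n = Σ f(ε_j) (p+1)^j.  Computed digit by digit with fuel;
-- fuel n is always enough (n / (m+1) < n for n ≥ 1, and f 0 = 0).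
cantorAux : (m p : ℕ) → (Fin (suc m) → Fin (suc p)) → ℕ → ℕ → ℕ
cantorAux m p f zero    n = 0
cantorAux m p f (suc k) n =
  toℕ (f (n mod suc m)) + suc p * cantorAux m p f k (n / suc m)

C : (m p : ℕ) → (Fin (suc m) → Fin (suc p)) → ℕ → ℕ
C m p f n = cantorAux m p f n n

-- Real inequality  A / N^α ≤ B / n^α  with α = log(p+1)/log(m+1),
-- for positive integers with A ≥ B > 0 and N > n > 0, i.e.
--   log(A/B) / log(N/n) ≤ log(p+1)/log(m+1),
-- expressed without reals through rational cuts: for every rational b/a (a ≥ 1),
--   b/a < log_{N/n}(A/B)  (⇔ N^b B^a < A^a n^b)
--   implies  b/a ≤ log_{m+1}(p+1)  (⇔ (m+1)^b ≤ (p+1)^a).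
RatioPowLe : (m p A N B n : ℕ) → Set
RatioPowLe m p A N B n =
  ∀ a b → 1 ≤ a → N ^ b * B ^ a < A ^ a * n ^ b → suc m ^ b ≤ suc p ^ a

{-# OPTIONS --safe #-}
-- Write M = m + 1 and P = p + 1.  Appending the digit ε gives C(Mn + ε) = f(ε) + P·C(n)
-- with f(ε) ≤ p.  From C(n) ≥ n and C(n) ≥ P·C(⌊n/M⌋) one gets P^k (n + 1) ≤ M^(k+1) C(n)
-- for n ≥ M^k, and since P > M, Bernoulli's inequality turns this into p·M·n ≤ P·C(n) for
-- large n.  Then f(ε)·M·n ≤ ε·P·C(n), i.e. C(Mn + ε)/C(n) ≤ (P/M)·(Mn + ε)/n.
-- Finally, for N = Mn + ε we have N/n ≥ M and α ≥ 1, so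
-- (N/n)^α = (N/n)·(N/n)^(α-1) ≥ (N/n)·M^(α-1) = (N/n)·(P/M),
-- which, cross-multiplied against the rational cuts of α, is the claim.
module Submission where

open import Defs
open import Data.Nat using (ℕ; suc; _+_; _*_; _^_; _≤_; _<_)
open import Data.Fin using (Fin)
open import Data.Product using (Σ)

open import Data.Nat using (zero; NonZero; >-nonZero; z≤n; s≤s; s≤s⁻¹; _≤′_; ≤′-refl; ≤′-step; _≤?_)
open import Data.Nat.Properties
open import Data.Nat.DivMod
open import Data.Nat.Divisibility using (m∣m*n)
open import Data.Nat.Induction using (<-rec)
open import Data.Nat.Tactic.RingSolver using (solve-∀)
open import Data.Fin using (toℕ; fromℕ<; inject₁) renaming (zero to fzero; suc to fsuc)
open import Data.Fin.Properties using (toℕ-fromℕ<; toℕ-inject₁; toℕ-injective; toℕ≤pred[n]; ≤̄⇒inject₁<)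
  renaming (≤-refl to ≤ᶠ-refl)
open import Data.Fin.Induction using (<-weakInduction)
open import Data.Product using (_,_)
open import Relation.Nullary using (yes; no; contradiction)
open import Relation.Binary.PropositionalEquality using (_≡_; refl; sym; trans; cong; cong₂; module ≡-Reasoning)

^-distribʳ-* : ∀ m n o → (m * n) ^ o ≡ m ^ o * n ^ o
^-distribʳ-* m n zero    = refl
^-distribʳ-* m n (suc o) = trans (cong (m * n *_) (^-distribʳ-* m n o))
                                 ([m*n]*[o*p]≡[m*o]*[n*p] m n (m ^ o) (n ^ o))

bernoulli : ∀ m k → (m + k) * m ^ k ≤ m * suc m ^ k
bernoulli m zero    = ≤-reflexive (cong (_* 1) (+-identityʳ m))
bernoulli m (suc k) = begin
  (m + suc k) * (m * m ^ k)              ≤⟨ m≤m+n _ (k * m ^ k) ⟩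
  (m + suc k) * (m * m ^ k) + k * m ^ k  ≡⟨ regroup m k (m ^ k) ⟩
  suc m * ((m + k) * m ^ k)              ≤⟨ *-monoʳ-≤ (suc m) (bernoulli m k) ⟩
  suc m * (m * suc m ^ k)                ≡⟨ swap m (suc m ^ k) ⟩
  m * suc m ^ suc k                      ∎
  where
  open ≤-Reasoning
  regroup : ∀ m k x → (m + suc k) * (m * x) + k * x ≡ suc m * ((m + k) * x)
  regroup = solve-∀
  swap : ∀ m x → suc m * (m * x) ≡ m * (suc m * x)
  swap = solve-∀

power-comparison : ∀ {A B N n M P a b} .{{_ : NonZero M}} → a ≤ b →
  A * M * n ≤ N * P * B → M * n ≤ N → P ^ a ≤ M ^ b → A ^ a * n ^ b ≤ N ^ b * B ^ a
power-comparison {A} {B} {N} {n} {M} {P} {a} a≤b AMn≤NPB Mn≤N P^a≤M^b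
  with d , refl ← m≤n⇒∃[o]m+o≡n a≤b =
  *-cancelˡ-≤ (M ^ a) {{m^n≢0 M a}} (begin
    M ^ a * (A ^ a * n ^ (a + d))
      ≡⟨ cong (λ x → M ^ a * (A ^ a * x)) (^-distribˡ-+-* n a d) ⟩
    M ^ a * (A ^ a * (n ^ a * n ^ d))
      ≡⟨ trans (regroupˡ (M ^ a) (A ^ a) (n ^ a) (n ^ d))
               (cong (_* n ^ d) (sym (^-distrib³ A M n))) ⟩
    (A * M * n) ^ a * n ^ d
      ≤⟨ *-monoˡ-≤ (n ^ d) (^-monoˡ-≤ a AMn≤NPB) ⟩
    (N * P * B) ^ a * n ^ d
      ≡⟨ trans (cong (_* n ^ d) (^-distrib³ N P B))
               (regroupʳ (N ^ a) (P ^ a) (B ^ a) (n ^ d)) ⟩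
    N ^ a * B ^ a * (P ^ a * n ^ d)
      ≤⟨ *-monoʳ-≤ (N ^ a * B ^ a) (*-monoˡ-≤ (n ^ d) P^a≤M^b) ⟩
    N ^ a * B ^ a * (M ^ (a + d) * n ^ d)
      ≡⟨ cong (N ^ a * B ^ a *_) (trans (cong (_* n ^ d) (^-distribˡ-+-* M a d))
                                        (*-assoc (M ^ a) (M ^ d) (n ^ d))) ⟩
    N ^ a * B ^ a * (M ^ a * (M ^ d * n ^ d))
      ≡⟨ cong (λ x → N ^ a * B ^ a * (M ^ a * x)) (sym (^-distribʳ-* M n d)) ⟩
    N ^ a * B ^ a * (M ^ a * (M * n) ^ d)
      ≤⟨ *-monoʳ-≤ (N ^ a * B ^ a) (*-monoʳ-≤ (M ^ a) (^-monoˡ-≤ d Mn≤N)) ⟩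
    N ^ a * B ^ a * (M ^ a * N ^ d)
      ≡⟨ trans (regroup (N ^ a) (B ^ a) (M ^ a) (N ^ d))
               (cong (λ x → M ^ a * (x * B ^ a)) (sym (^-distribˡ-+-* N a d))) ⟩
    M ^ a * (N ^ (a + d) * B ^ a) ∎)
  where
  open ≤-Reasoning
  ^-distrib³ : ∀ x y z → (x * y * z) ^ a ≡ x ^ a * y ^ a * z ^ a
  ^-distrib³ x y z = trans (^-distribʳ-* (x * y) z a) (cong (_* z ^ a) (^-distribʳ-* x y a))
  regroupˡ : ∀ x y z w → x * (y * (z * w)) ≡ y * x * z * w
  regroupˡ = solve-∀
  regroupʳ : ∀ x y z w → x * y * z * w ≡ x * z * (y * w)
  regroupʳ = solve-∀
  regroup : ∀ x y z w → x * y * (z * w) ≡ z * (x * w * y)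
  regroup = solve-∀

ratioPowLe-intro : ∀ {m p A N B n} → m ≤ p →
  A * suc m * n ≤ N * suc p * B → suc m * n ≤ N → RatioPowLe m p A N B n
ratioPowLe-intro {m} {p} m≤p AMn≤NPB Mn≤N a b _ N^bB^a<A^an^b
  with a ≤? b
... | no a≰b = ≤-trans (^-monoʳ-≤ (suc m) (<⇒≤ (≰⇒> a≰b))) (^-monoˡ-≤ a (s≤s m≤p))
... | yes a≤b with suc m ^ b ≤? suc p ^ a
...   | yes M^b≤P^a = M^b≤P^a
...   | no M^b≰P^a = contradiction
          (power-comparison a≤b AMn≤NPB Mn≤N (≰⇒≥ M^b≰P^a)) (<⇒≱ N^bB^a<A^an^b)

m<n*[1+m/n] : ∀ m n .{{_ : NonZero n}} → m < n * suc (m / n)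
m<n*[1+m/n] m n = begin-strict
  m                  ≡⟨ m≡m%n+[m/n]*n m n ⟩
  m % n + m / n * n  <⟨ +-monoˡ-< (m / n * n) (m%n<n m n) ⟩
  n + m / n * n      ≡⟨ cong (n +_) (*-comm (m / n) n) ⟩
  n + n * (m / n)    ≡⟨ *-suc n (m / n) ⟨
  n * suc (m / n)    ∎
  where open ≤-Reasoning

m*n≤o⇒m≤o/n : ∀ {m n o} .{{_ : NonZero n}} → m * n ≤ o → m ≤ o / n
m*n≤o⇒m≤o/n {m} {n} mn≤o = ≤-trans (≤-reflexive (sym (m*n/n≡m m n))) (/-monoˡ-≤ n mn≤o)

[d*q+r]/d≡q : ∀ d q {r} .{{_ : NonZero d}} → r < d → (d * q + r) / d ≡ q
[d*q+r]/d≡q d q {r} r<d = begin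
  (d * q + r) / d        ≡⟨ +-distrib-/-∣ˡ r (m∣m*n q) ⟩
  d * q / d + r / d      ≡⟨ cong₂ _+_ (trans (/-congˡ (*-comm d q)) (m*n/n≡m q d)) (m<n⇒m/n≡0 r<d) ⟩
  q + 0                  ≡⟨ +-identityʳ q ⟩
  q                      ∎
  where open ≡-Reasoning

[d*q+r]%d≡r : ∀ d q {r} .{{_ : NonZero d}} → r < d → (d * q + r) % d ≡ r
[d*q+r]%d≡r d q r<d = trans (%-remove-+ˡ _ (m∣m*n q)) (m<n⇒m%n≡m r<d)

strictlyIncreasing⇒inflationary : ∀ {m p} {f : Fin (suc m) → Fin (suc p)} →
  StrictlyIncreasing f → ∀ i → toℕ i ≤ toℕ (f i)
strictlyIncreasing⇒inflationary {f = f} inc = <-weakInduction (λ i → toℕ i ≤ toℕ (f i)) z≤n step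
  where
  step : ∀ i → toℕ (inject₁ i) ≤ toℕ (f (inject₁ i)) → toℕ (fsuc i) ≤ toℕ (f (fsuc i))
  step i ih = ≤-trans (s≤s (≤-trans (≤-reflexive (sym (toℕ-inject₁ i))) ih))
                      (inc (inject₁ i) (fsuc i) (≤̄⇒inject₁< ≤ᶠ-refl))

module CantorIntegers {m p : ℕ} (f : Fin (suc m) → Fin (suc p))
                      (1≤m : 1 ≤ m) (f0≡0 : toℕ (f fzero) ≡ 0) where

  M P : ℕ
  M = suc m
  P = suc p

  c : ℕ → ℕ
  c = C m p f

  n≤1+k⇒n/M≤k : ∀ {k} n → n ≤ suc k → n / M ≤ k
  n≤1+k⇒n/M≤k zero    _      = z≤n
  n≤1+k⇒n/M≤k (suc n) n≤1+k = s≤s⁻¹ (≤-trans (m/n<m (suc n) M (s≤s 1≤m)) n≤1+k)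

  cantorAux-suc : ∀ {k n} → n ≤ k → cantorAux m p f (suc k) n ≡ cantorAux m p f k n
  cantorAux-suc {zero}  {zero} _   = cong₂ _+_ f0≡0 (*-zeroʳ P)
  cantorAux-suc {suc k} {n}    n≤k =
    cong (λ x → toℕ (f (n mod M)) + P * x) (cantorAux-suc (n≤1+k⇒n/M≤k n n≤k))

  cantorAux≡C : ∀ {k n} → n ≤′ k → cantorAux m p f k n ≡ c n
  cantorAux≡C ≤′-refl        = refl
  cantorAux≡C (≤′-step n≤′k) = trans (cantorAux-suc (≤′⇒≤ n≤′k)) (cantorAux≡C n≤′k)

  C-unfold : ∀ n → c n ≡ toℕ (f (n mod M)) + P * c (n / M)
  C-unfold zero    = sym (cong₂ _+_ f0≡0 (*-zeroʳ P))
  C-unfold (suc n) = cong (λ x → toℕ (f (suc n mod M)) + P * x)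
                          (cantorAux≡C (≤⇒≤′ (n≤1+k⇒n/M≤k (suc n) ≤-refl)))

  C-digit : ∀ n {r} (r<M : r < M) → c (M * n + r) ≡ toℕ (f (fromℕ< r<M)) + P * c n
  C-digit n {r} r<M = trans (C-unfold (M * n + r))
    (cong₂ (λ i q → toℕ (f i) + P * c q) last-digit ([d*q+r]/d≡q M n r<M))
    where
    last-digit : (M * n + r) mod M ≡ fromℕ< r<M
    last-digit = toℕ-injective
      (trans (toℕ-fromℕ< _) (trans ([d*q+r]%d≡r M n r<M) (sym (toℕ-fromℕ< r<M))))

  module Growth (m<p : m < p) (inc : StrictlyIncreasing f) where

    M≤P : M ≤ P
    M≤P = s≤s (<⇒≤ m<p)

    n≤C[n] : ∀ n → n ≤ c n
    n≤C[n] = <-rec (λ n → n ≤ c n) step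
      where
      step : ∀ n → (∀ {k} → k < n → k ≤ c k) → n ≤ c n
      step zero      _  = z≤n
      step n@(suc _) ih = begin
        n                                  ≡⟨ m≡m%n+[m/n]*n n M ⟩
        n % M + n / M * M                  ≤⟨ +-mono-≤ last-digit≤ (*-mono-≤ (ih n/M<n) M≤P) ⟩
        toℕ (f (n mod M)) + c (n / M) * P  ≡⟨ cong (toℕ (f (n mod M)) +_) (*-comm (c (n / M)) P) ⟩
        toℕ (f (n mod M)) + P * c (n / M)  ≡⟨ C-unfold n ⟨
        c n                                ∎
        where
        open ≤-Reasoning
        last-digit≤ : n % M ≤ toℕ (f (n mod M))
        last-digit≤ = ≤-trans (≤-reflexive (sym (toℕ-fromℕ< _)))
                              (strictlyIncreasing⇒inflationary inc (n mod M))
        n/M<n : n / M < n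
        n/M<n = m/n<m n M (s≤s 1≤m)

    P*C[n/M]≤C : ∀ n → P * c (n / M) ≤ c n
    P*C[n/M]≤C n = ≤-trans (m≤n+m (P * c (n / M)) (toℕ (f (n mod M))))
                           (≤-reflexive (sym (C-unfold n)))

    P^k*[1+n]≤M^[1+k]*C[n] : ∀ k n → M ^ k ≤ n → P ^ k * suc n ≤ M ^ suc k * c n
    P^k*[1+n]≤M^[1+k]*C[n] zero n 1≤n = begin
      1 * suc n      ≡⟨ *-identityˡ (suc n) ⟩
      1 + n          ≤⟨ +-monoˡ-≤ n 1≤n ⟩
      n + n          ≡⟨ cong (n +_) (+-identityʳ n) ⟨
      2 * n          ≤⟨ *-monoˡ-≤ n (s≤s 1≤m) ⟩
      M * n          ≤⟨ *-monoʳ-≤ M (n≤C[n] n) ⟩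
      M * c n        ≡⟨ cong (_* c n) (*-identityʳ M) ⟨
      M ^ 1 * c n    ∎
      where open ≤-Reasoning
    P^k*[1+n]≤M^[1+k]*C[n] (suc k) n M^[1+k]≤n = begin
      P * P ^ k * suc n            ≤⟨ *-monoʳ-≤ (P * P ^ k) (m<n*[1+m/n] n M) ⟩
      P * P ^ k * (M * suc q)      ≡⟨ [m*n]*[o*p]≡[m*o]*[n*p] P (P ^ k) M (suc q) ⟩
      P * M * (P ^ k * suc q)      ≤⟨ *-monoʳ-≤ (P * M) (P^k*[1+n]≤M^[1+k]*C[n] k q M^k≤q) ⟩
      P * M * (M ^ suc k * c q)    ≡⟨ regroup P M (M ^ suc k) (c q) ⟩
      M ^ suc (suc k) * (P * c q)  ≤⟨ *-monoʳ-≤ (M ^ suc (suc k)) (P*C[n/M]≤C n) ⟩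
      M ^ suc (suc k) * c n        ∎
      where
      open ≤-Reasoning
      q = n / M
      M^k≤q : M ^ k ≤ q
      M^k≤q = m*n≤o⇒m≤o/n (≤-trans (≤-reflexive (*-comm (M ^ k) M)) M^[1+k]≤n)
      regroup : ∀ x y z w → x * y * (z * w) ≡ y * z * (x * w)
      regroup = solve-∀

    k₀ : ℕ
    k₀ = p * M * M

    -- By Bernoulli, (P/M)^k ≥ (1 + 1/M)^k ≥ 1 + k/M; the choice k₀ = p M² makes this exceed p M.
    k₀*M^k₀≤P^[1+k₀] : k₀ * M ^ k₀ ≤ P ^ suc k₀
    k₀*M^k₀≤P^[1+k₀] = begin
      k₀ * M ^ k₀        ≤⟨ *-monoˡ-≤ (M ^ k₀) (m≤n+m k₀ M) ⟩
      (M + k₀) * M ^ k₀  ≤⟨ bernoulli M k₀ ⟩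
      M * suc M ^ k₀     ≤⟨ *-mono-≤ M≤P (^-monoˡ-≤ k₀ (s≤s m<p)) ⟩
      P ^ suc k₀         ∎
      where open ≤-Reasoning

    p*[M*n]≤P*C[n] : ∀ n → M ^ k₀ ≤ n → p * (M * n) ≤ P * c n
    p*[M*n]≤P*C[n] n M^k₀≤n = *-cancelˡ-≤ (M ^ suc k₀) {{m^n≢0 M (suc k₀)}} (begin
      M ^ suc k₀ * (p * (M * n))  ≡⟨ regroupˡ M (M ^ k₀) p n ⟩
      k₀ * M ^ k₀ * n             ≤⟨ *-monoˡ-≤ n k₀*M^k₀≤P^[1+k₀] ⟩
      P ^ suc k₀ * n              ≤⟨ *-monoʳ-≤ (P ^ suc k₀) (n≤1+n n) ⟩
      P * P ^ k₀ * suc n          ≡⟨ *-assoc P (P ^ k₀) (suc n) ⟩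
      P * (P ^ k₀ * suc n)        ≤⟨ *-monoʳ-≤ P (P^k*[1+n]≤M^[1+k]*C[n] k₀ n M^k₀≤n) ⟩
      P * (M ^ suc k₀ * c n)      ≡⟨ regroupʳ P (M ^ suc k₀) (c n) ⟩
      M ^ suc k₀ * (P * c n)      ∎)
      where
      open ≤-Reasoning
      regroupˡ : ∀ M X p n → M * X * (p * (M * n)) ≡ p * M * M * X * n
      regroupˡ = solve-∀
      regroupʳ : ∀ x y z → x * (y * z) ≡ y * (x * z)
      regroupʳ = solve-∀

    C[Mn+ε]*Mn≤[Mn+ε]*P*C[n] : ∀ n → M ^ k₀ ≤ n → ∀ {ε} → 1 ≤ ε → ε < M →
      c (M * n + ε) * M * n ≤ (M * n + ε) * P * c n
    C[Mn+ε]*Mn≤[Mn+ε]*P*C[n] n M^k₀≤n {ε} 1≤ε ε<M = begin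
      c (M * n + ε) * M * n                ≡⟨ cong (λ x → x * M * n) (C-digit n ε<M) ⟩
      (d + P * c n) * M * n                ≡⟨ expand d (P * c n) M n ⟩
      d * (M * n) + M * n * (P * c n)      ≤⟨ +-monoˡ-≤ _ (*-monoˡ-≤ (M * n) d≤p) ⟩
      p * (M * n) + M * n * (P * c n)      ≤⟨ +-monoˡ-≤ _ (≤-trans (p*[M*n]≤P*C[n] n M^k₀≤n) P*C≤ε*P*C) ⟩
      ε * (P * c n) + M * n * (P * c n)    ≡⟨ collect ε P (c n) (M * n) ⟩
      (M * n + ε) * P * c n                ∎
      where
      open ≤-Reasoning
      d = toℕ (f (fromℕ< ε<M))
      d≤p : d ≤ p
      d≤p = toℕ≤pred[n] (f (fromℕ< ε<M))
      P*C≤ε*P*C : P * c n ≤ ε * (P * c n)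
      P*C≤ε*P*C = m≤n*m (P * c n) ε {{>-nonZero 1≤ε}}
      expand : ∀ d x M n → (d + x) * M * n ≡ d * (M * n) + M * n * x
      expand = solve-∀
      collect : ∀ e P C y → e * (P * C) + y * (P * C) ≡ (y + e) * P * C
      collect = solve-∀

proposition2p3 : (m p : ℕ) → 1 ≤ m → m < p →
    (f : Fin (suc m) → Fin (suc p)) → IsDigitMap m p f →
    Σ ℕ (λ k₀ → (n : ℕ) → suc m ^ k₀ ≤ n → (ε : ℕ) → 1 ≤ ε → ε ≤ m →
      RatioPowLe m p (C m p f (suc m * n + ε)) (suc m * n + ε) (C m p f n) n)
proposition2p3 m p 1≤m m<p f (inc , f0≡0 , _) = k₀ , λ n M^k₀≤n ε 1≤ε ε≤m →
  ratioPowLe-intro (<⇒≤ m<p)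
    (C[Mn+ε]*Mn≤[Mn+ε]*P*C[n] n M^k₀≤n 1≤ε (s≤s ε≤m))
    (m≤m+n (suc m * n) ε)
  where
  open CantorIntegers f 1≤m f0≡0
  open Growth m<p inc
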